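{- Let $G$ be a connected bipartite $k$-regular multigraph with $k\ge 3$. Let $e',e''$ be two vertex-disjoint edges of $G$ such that the graph $G\setminus\{e',e''\}$ (obtained by deleting these two edges) has a connected component $H$ containing exactly one endpoint $u'$ of $e'$ and exactly one endpoint $u''$ of $e''$. Then $u'$ and $u''$ lie in distinct parts of the (unique) bipartition of $V(G)$.
   Context: Multigraphs are loopless but may have parallel edges; $k$-regular means every vertex is incident with exactly $k$ edges (counting multiplicity). -}

module Defs where

open import Data.Nat using (ℕ)
open import Data.Fin using (Fin)
open import Data.Fin.Properties using (_≟_)
open import Data.Bool using (Bool)
open import Data.Product using (Σ; _×_; _,_; proj₁; proj₂)
open import Data.Unit using (⊤)
open import Data.Sum using (_⊎_)
open import Data.List using (List; length; filter)
open import Data.List.Base using (allFin)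
open import Relation.Nullary using (¬_; Dec)
open import Relation.Nullary.Decidable using (_⊎-dec_)
open import Relation.Binary.PropositionalEquality using (_≡_)

-- A finite loopless multigraph: vertices Fin n, edges Fin m,
-- each edge has an (ordered, for bookkeeping) pair of distinct endpoints.
-- Parallel edges are allowed (different edge indices with equal endpoints).
record Multigraph : Set where
  field
    n        : ℕ
    m        : ℕ
    ends     : Fin m → Fin n × Fin n
    loopless : ∀ e → ¬ (proj₁ (ends e) ≡ proj₂ (ends e))

module _ (G : Multigraph) where
  open Multigraph G

  Vertex : Set
  Vertex = Fin n

  Edge : Set
  Edge = Fin m

  Incident : Edge → Vertex → Set
  Incident e v = (proj₁ (ends e) ≡ v) ⊎ (proj₂ (ends e) ≡ v)

  incident? : ∀ e v → Dec (Incident e v)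
  incident? e v = (proj₁ (ends e) ≟ v) ⊎-dec (proj₂ (ends e) ≟ v)

  -- degree = number of edges incident with v (each edge counts once, as G is loopless)
  degree : Vertex → ℕ
  degree v = length (filter (λ e → incident? e v) (allFin m))

  Regular : ℕ → Set
  Regular k = ∀ v → degree v ≡ k

  -- walks using only edges satisfying the predicate `Allowed`
  -- (Allowed e = ¬ (e ≡ e') × ¬ (e ≡ e'') gives the graph G ∖ {e', e''})
  data Reach (Allowed : Edge → Set) : Vertex → Vertex → Set where
    here : ∀ {x} → Reach Allowed x x
    fwd  : ∀ {y} e → Allowed e → Reach Allowed (proj₂ (ends e)) y →
           Reach Allowed (proj₁ (ends e)) y
    bwd  : ∀ {y} e → Allowed e → Reach Allowed (proj₁ (ends e)) y →
           Reach Allowed (proj₂ (ends e)) y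

  AllEdges : Edge → Set
  AllEdges _ = ⊤

  Connected : Set
  Connected = ∀ x y → Reach AllEdges x y

  ProperTwoColouring : (Vertex → Bool) → Set
  ProperTwoColouring c = ∀ e → ¬ (c (proj₁ (ends e)) ≡ c (proj₂ (ends e)))

  Bipartite : Set
  Bipartite = Σ (Vertex → Bool) ProperTwoColouring

  IsComponent : (Edge → Set) → (Vertex → Set) → Set
  IsComponent Allowed H =
    Σ Vertex H ×
    (∀ x y → H x → H y → Reach Allowed x y) ×
    (∀ x y → H x → Reach Allowed x y → H y)

-- Let S be the vertex set of the component H and c a proper 2-colouring. Each edge
-- inside S contributes one endpoint to each colour class of S, so by counting
-- edge-ends k·|S ∩ c⁻¹(b)| + #(edges leaving S from colour ¬b) equals
-- k·|S ∩ c⁻¹(¬b)| + #(edges leaving S from colour b). Only e′ and e″ leave S; if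
-- u′ and u″ had the same colour β, this would give k·|S ∩ c⁻¹(β)| = k·|S ∩ c⁻¹(¬β)| + 2,
-- so k would divide 2, contradicting k ≥ 3.
module Submission where

open import Defs
open import Data.Nat using (ℕ; _≥_; _*_; _+_; suc)
open import Data.Nat.Properties
  using (+-*-semiring; *-comm; +-identityʳ; *-zeroʳ; *-identityʳ; *-distribˡ-+; <-irrefl; ≤-trans)
open import Data.Nat.Divisibility using (_∣_; m∣m*n; ∣m+n∣m⇒∣n; ∣⇒≤)
open import Data.Bool using (Bool; true; false; not; if_then_else_)
open import Data.Bool.Properties using (¬-not) renaming (_≟_ to _≟ᵇ_)
open import Data.Fin using (Fin; punchIn; punchOut)
open import Data.Fin.Properties using (_≟_; punchInᵢ≢i; punchIn-injective; punchIn-punchOut)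
open import Data.Product using (_×_; proj₁; proj₂; _,_)
open import Data.Sum using (inj₁; inj₂)
open import Data.List using (length; filter; tabulate)
open import Function using (_∘_; mk⇔)
open import Relation.Nullary using (¬_; Dec; yes; no; does)
open import Relation.Nullary.Decidable using (_⊎-dec_; dec-true; dec-false; does-⇔; ¬¬-excluded-middle)
open import Relation.Nullary.Negation using (contradiction)
open import Relation.Binary.PropositionalEquality
  using (_≡_; _≢_; refl; sym; trans; cong; cong₂; subst; ≢-sym; module ≡-Reasoning)
open import Algebra.Properties.Semiring.Sum +-*-semiring
  using (sum; sum-syntax; sum-cong-≗; sum-replicate-zero; sum-remove; ∑-distrib-+; ∑-comm; *-distribˡ-sum; *-distribʳ-sum)

open ≡-Reasoning

indicator : ∀ {a} {A : Set a} → Dec A → ℕ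
indicator a? = if does a? then 1 else 0

indicator-yes : ∀ {a} {A : Set a} (a? : Dec A) → A → indicator a? ≡ 1
indicator-yes (yes _) _ = refl
indicator-yes (no ¬a) a = contradiction a ¬a

indicator-no : ∀ {a} {A : Set a} (a? : Dec A) → ¬ A → indicator a? ≡ 0
indicator-no (yes a) ¬a = contradiction a ¬a
indicator-no (no _)  _  = refl

indicator-⊎-dec : ∀ {a b} {A : Set a} {B : Set b} (a? : Dec A) (b? : Dec B) →
                  ¬ (A × B) → indicator (a? ⊎-dec b?) ≡ indicator a? + indicator b?
indicator-⊎-dec (yes a) (yes b) ¬a×b = contradiction (a , b) ¬a×b
indicator-⊎-dec (yes _) (no _)  _    = refl
indicator-⊎-dec (no _)  (yes _) _    = refl
indicator-⊎-dec (no _)  (no _)  _    = refl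

¬¬-decidable : ∀ {n p} (P : Fin n → Set p) → ¬ ¬ (∀ i → Dec (P i))
¬¬-decidable {ℕ.zero}  P ¬dec = ¬dec λ ()
¬¬-decidable {suc n} P ¬dec = ¬¬-excluded-middle λ P₀? →
  ¬¬-decidable (P ∘ Fin.suc) λ Pₛ? → ¬dec λ { Fin.zero → P₀? ; (Fin.suc i) → Pₛ? i }

sum-zero : ∀ {n} {f : Fin n → ℕ} → (∀ i → f i ≡ 0) → sum f ≡ 0
sum-zero {n} f≡0 = trans (sum-cong-≗ f≡0) (sum-replicate-zero n)

sum-supported-at : ∀ {n} (f : Fin n → ℕ) a → (∀ i → i ≢ a → f i ≡ 0) → sum f ≡ f a
sum-supported-at {suc n} f a f≡0 = begin
  sum f                       ≡⟨ sum-remove f ⟩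
  f a + sum (f ∘ punchIn a)   ≡⟨ cong (f a +_) (sum-zero (λ j → f≡0 _ (punchInᵢ≢i a j))) ⟩
  f a + 0                     ≡⟨ +-identityʳ (f a) ⟩
  f a                         ∎

sum-supported-at₂ : ∀ {n} (f : Fin n → ℕ) {a b} → a ≢ b →
                    (∀ i → i ≢ a → i ≢ b → f i ≡ 0) → sum f ≡ f a + f b
sum-supported-at₂ {suc n} f {a} {b} a≢b f≡0 = begin
  sum f                             ≡⟨ sum-remove f ⟩
  f a + sum (f ∘ punchIn a)         ≡⟨ cong (f a +_) (sum-supported-at (f ∘ punchIn a) b′ vanishes) ⟩
  f a + f (punchIn a b′)            ≡⟨ cong (λ i → f a + f i) (punchIn-punchOut a≢b) ⟩
  f a + f b                         ∎
  where
  b′ = punchOut a≢b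
  vanishes : ∀ j → j ≢ b′ → f (punchIn a j) ≡ 0
  vanishes j j≢b′ = f≡0 _ (punchInᵢ≢i a j)
    (λ eq → j≢b′ (punchIn-injective a j b′ (trans eq (sym (punchIn-punchOut a≢b)))))

sum-*-indicator : ∀ {n} (w : Fin n → ℕ) x → ∑[ v < n ] (w v * indicator (x ≟ v)) ≡ w x
sum-*-indicator {n} w x = begin
  ∑[ v < n ] (w v * indicator (x ≟ v))  ≡⟨ sum-supported-at _ x off ⟩
  w x * indicator (x ≟ x)               ≡⟨ cong (w x *_) (indicator-yes (x ≟ x) refl) ⟩
  w x * 1                               ≡⟨ *-identityʳ (w x) ⟩
  w x                                   ∎
  where
  off : ∀ v → v ≢ x → w v * indicator (x ≟ v) ≡ 0
  off v v≢x = trans (cong (w v *_) (indicator-no (x ≟ v) (≢-sym v≢x))) (*-zeroʳ (w v))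

length-filter-tabulate : ∀ {a p n} {A : Set a} {P : A → Set p} (P? : ∀ x → Dec (P x)) (f : Fin n → A) →
                         length (filter P? (tabulate f)) ≡ ∑[ i < n ] indicator (P? (f i))
length-filter-tabulate {n = ℕ.zero} P? f = refl
length-filter-tabulate {n = suc n} P? f with does (P? (f Fin.zero))
... | true  = cong suc (length-filter-tabulate P? (f ∘ Fin.suc))
... | false = length-filter-tabulate P? (f ∘ Fin.suc)

multiple≢multiple+2 : ∀ {k a b} → k ≥ 3 → k * a ≢ k * b + 2
multiple≢multiple+2 {k} {a} {b} k≥3 eq = <-irrefl refl (≤-trans k≥3 (∣⇒≤ k∣2))
  where
  k∣2 : k ∣ 2
  k∣2 = ∣m+n∣m⇒∣n (subst (k ∣_) eq (m∣m*n a)) (m∣m*n b)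

classWeight : Bool → Bool → Bool → ℕ
classWeight b s x = if s then indicator (x ≟ᵇ b) else 0

-- For an edge whose ends have membership s₁, s₂ in S and colours x₁, x₂:
-- 1 iff exactly one end lies in S and that end has colour b.
crossWeight : Bool → Bool → Bool → Bool → Bool → ℕ
crossWeight b true  false x₁ _  = classWeight b true x₁
crossWeight b false true  _  x₂ = classWeight b true x₂
crossWeight _ _     _     _  _  = 0

classWeight-self : ∀ b → classWeight b true b ≡ 1
classWeight-self true  = refl
classWeight-self false = refl

classWeight-not : ∀ b → classWeight (not b) true b ≡ 0
classWeight-not true  = refl
classWeight-not false = refl

crossWeight-diagonal : ∀ b s x₁ x₂ → crossWeight b s s x₁ x₂ ≡ 0
crossWeight-diagonal b true  x₁ x₂ = refl
crossWeight-diagonal b false x₁ x₂ = refl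

crossWeight-left : ∀ b {s₁ s₂} x₁ x₂ → s₁ ≡ true → s₂ ≡ false → crossWeight b s₁ s₂ x₁ x₂ ≡ classWeight b true x₁
crossWeight-left b x₁ x₂ refl refl = refl

crossWeight-right : ∀ b {s₁ s₂} x₁ x₂ → s₁ ≡ false → s₂ ≡ true → crossWeight b s₁ s₂ x₁ x₂ ≡ classWeight b true x₂
crossWeight-right b x₁ x₂ refl refl = refl

edge-balance : ∀ b s₁ s₂ {x₁ x₂} → x₁ ≢ x₂ →
  classWeight b s₁ x₁ + classWeight b s₂ x₂ + crossWeight (not b) s₁ s₂ x₁ x₂ ≡
  classWeight (not b) s₁ x₁ + classWeight (not b) s₂ x₂ + crossWeight b s₁ s₂ x₁ x₂
edge-balance b s₁ s₂ {x₂ = x₂} x₁≢x₂ rewrite ¬-not x₁≢x₂ = balance b s₁ s₂ x₂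
  where
  balance : ∀ b s₁ s₂ x →
    classWeight b s₁ (not x) + classWeight b s₂ x + crossWeight (not b) s₁ s₂ (not x) x ≡
    classWeight (not b) s₁ (not x) + classWeight (not b) s₂ x + crossWeight b s₁ s₂ (not x) x
  balance true  true  true  true  = refl
  balance true  true  true  false = refl
  balance true  true  false true  = refl
  balance true  true  false false = refl
  balance true  false true  true  = refl
  balance true  false true  false = refl
  balance true  false false true  = refl
  balance true  false false false = refl
  balance false true  true  true  = refl
  balance false true  true  false = refl
  balance false true  false true  = refl
  balance false true  false false = refl
  balance false false true  true  = refl
  balance false false true  false = refl
  balance false false false true  = refl
  balance false false false false = refl

module _ (G : Multigraph) where
  open Multigraph G

  end₁ end₂ : Edge G → Vertex G
  end₁ e = proj₁ (ends e)
  end₂ e = proj₂ (ends e)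

  degree-as-sum : ∀ v → degree G v ≡ ∑[ e < m ] indicator (incident? G e v)
  degree-as-sum v = length-filter-tabulate (λ e → incident? G e v) (λ e → e)

  incidence-indicator : ∀ e v → indicator (incident? G e v) ≡ indicator (end₁ e ≟ v) + indicator (end₂ e ≟ v)
  incidence-indicator e v = indicator-⊎-dec (end₁ e ≟ v) (end₂ e ≟ v) (λ (p , q) → loopless e (trans p (sym q)))

  weighted-handshake : (w : Vertex G → ℕ) →
    ∑[ v < n ] (w v * degree G v) ≡ ∑[ e < m ] (w (end₁ e) + w (end₂ e))
  weighted-handshake w = begin
    ∑[ v < n ] (w v * degree G v)                               ≡⟨ sum-cong-≗ (λ v → cong (w v *_) (degree-as-sum v)) ⟩
    ∑[ v < n ] (w v * ∑[ e < m ] indicator (incident? G e v))   ≡⟨ sum-cong-≗ (λ v → *-distribˡ-sum (w v) (λ e → indicator (incident? G e v))) ⟩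
    ∑[ v < n ] ∑[ e < m ] (w v * indicator (incident? G e v))   ≡⟨ ∑-comm (λ v e → w v * indicator (incident? G e v)) ⟩
    ∑[ e < m ] ∑[ v < n ] (w v * indicator (incident? G e v))   ≡⟨ sum-cong-≗ ends-sum ⟩
    ∑[ e < m ] (w (end₁ e) + w (end₂ e))                        ∎
    where
    ends-sum : ∀ e → ∑[ v < n ] (w v * indicator (incident? G e v)) ≡ w (end₁ e) + w (end₂ e)
    ends-sum e = begin
      ∑[ v < n ] (w v * indicator (incident? G e v))
        ≡⟨ sum-cong-≗ (λ v → trans (cong (w v *_) (incidence-indicator e v)) (*-distribˡ-+ (w v) _ _)) ⟩
      ∑[ v < n ] (w v * indicator (end₁ e ≟ v) + w v * indicator (end₂ e ≟ v))
        ≡⟨ ∑-distrib-+ (λ v → w v * indicator (end₁ e ≟ v)) (λ v → w v * indicator (end₂ e ≟ v)) ⟩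
      ∑[ v < n ] (w v * indicator (end₁ e ≟ v)) + ∑[ v < n ] (w v * indicator (end₂ e ≟ v))
        ≡⟨ cong₂ _+_ (sum-*-indicator w (end₁ e)) (sum-*-indicator w (end₂ e)) ⟩
      w (end₁ e) + w (end₂ e) ∎

  regular-handshake : ∀ {k} → Regular G k → (w : Vertex G → ℕ) →
    k * sum w ≡ ∑[ e < m ] (w (end₁ e) + w (end₂ e))
  regular-handshake {k} regular w = begin
    k * sum w                        ≡⟨ *-comm k (sum w) ⟩
    sum w * k                        ≡⟨ *-distribʳ-sum k w ⟩
    ∑[ v < n ] (w v * k)             ≡⟨ sum-cong-≗ (λ v → cong (w v *_) (sym (regular v))) ⟩
    ∑[ v < n ] (w v * degree G v)    ≡⟨ weighted-handshake w ⟩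
    ∑[ e < m ] (w (end₁ e) + w (end₂ e)) ∎

  module _ {p} {S : Vertex G → Set p} (S? : ∀ v → Dec (S v)) (c : Vertex G → Bool) where

    inS : Vertex G → Bool
    inS v = does (S? v)

    classSize : Bool → ℕ
    classSize b = ∑[ v < n ] classWeight b (inS v) (c v)

    crossing : Bool → Edge G → ℕ
    crossing b e = crossWeight b (inS (end₁ e)) (inS (end₂ e)) (c (end₁ e)) (c (end₂ e))

    cutSize : Bool → ℕ
    cutSize b = ∑[ e < m ] crossing b e

    LeavesAt : Edge G → Vertex G → Set p
    LeavesAt e u = Incident G e u × S u × (∀ v → Incident G e v → S v → v ≡ u)

    class-cut-balance : ∀ {k} → Regular G k → ProperTwoColouring G c → ∀ b →
      k * classSize b + cutSize (not b) ≡ k * classSize (not b) + cutSize b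
    class-cut-balance {k} regular proper b = begin
      k * classSize b + cutSize (not b)                   ≡⟨ cong (_+ cutSize (not b)) (regular-handshake regular (w b)) ⟩
      ∑[ e < m ] (w b (end₁ e) + w b (end₂ e)) + cutSize (not b)
        ≡⟨ ∑-distrib-+ (ends-weight b) (crossing (not b)) ⟨
      ∑[ e < m ] (w b (end₁ e) + w b (end₂ e) + crossing (not b) e)
        ≡⟨ sum-cong-≗ (λ e → edge-balance b (inS (end₁ e)) (inS (end₂ e)) (proper e)) ⟩
      ∑[ e < m ] (w (not b) (end₁ e) + w (not b) (end₂ e) + crossing b e)
        ≡⟨ ∑-distrib-+ (ends-weight (not b)) (crossing b) ⟩
      ∑[ e < m ] (w (not b) (end₁ e) + w (not b) (end₂ e)) + cutSize b
        ≡⟨ cong (_+ cutSize b) (regular-handshake regular (w (not b))) ⟨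
      k * classSize (not b) + cutSize b                   ∎
      where
      w : Bool → Vertex G → ℕ
      w b v = classWeight b (inS v) (c v)
      ends-weight : Bool → Edge G → ℕ
      ends-weight b e = w b (end₁ e) + w b (end₂ e)

    crossing-internal : ∀ b e → (S (end₁ e) → S (end₂ e)) → (S (end₂ e) → S (end₁ e)) → crossing b e ≡ 0
    crossing-internal b e to from
      rewrite does-⇔ (mk⇔ to from) (S? (end₁ e)) (S? (end₂ e)) = crossWeight-diagonal b (inS (end₂ e)) (c (end₁ e)) (c (end₂ e))

    crossing-leaving : ∀ b {e u} → LeavesAt e u → crossing b e ≡ classWeight b true (c u)
    crossing-leaving b {e} (inj₁ refl , Su , unique) =
      crossWeight-left b _ _ (dec-true (S? _) Su)
        (dec-false (S? _) (λ S₂ → loopless e (sym (unique _ (inj₂ refl) S₂))))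
    crossing-leaving b {e} (inj₂ refl , Su , unique) =
      crossWeight-right b _ _ (dec-false (S? _) (λ S₁ → loopless e (unique _ (inj₁ refl) S₁))) (dec-true (S? _) Su)

    two-edges-leaving : ∀ {e′ e″ u′ u″} → e′ ≢ e″ →
      (∀ x y → S x → Reach G (λ e → ¬ (e ≡ e′) × ¬ (e ≡ e″)) x y → S y) →
      LeavesAt e′ u′ → LeavesAt e″ u″ → c u′ ≡ c u″ →
      ∀ {k} → Regular G k → ProperTwoColouring G c →
      k * classSize (c u′) ≡ k * classSize (not (c u′)) + 2
    two-edges-leaving {e′} {e″} {u′} {u″} e′≢e″ closed leaves′ leaves″ same {k} regular proper = begin
      k * classSize β                          ≡⟨ +-identityʳ _ ⟨
      k * classSize β + 0                      ≡⟨ cong (k * classSize β +_) (cut (not β) (classWeight-not β)) ⟨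
      k * classSize β + cutSize (not β)        ≡⟨ class-cut-balance regular proper β ⟩
      k * classSize (not β) + cutSize β        ≡⟨ cong (k * classSize (not β) +_) (cut β (classWeight-self β)) ⟩
      k * classSize (not β) + 2                ∎
      where
      β = c u′
      cut : ∀ b {r} → classWeight b true β ≡ r → cutSize b ≡ r + r
      cut b {r} weight = begin
        cutSize b                         ≡⟨ sum-supported-at₂ (crossing b) e′≢e″ internal ⟩
        crossing b e′ + crossing b e″     ≡⟨ cong₂ _+_ (crossing-leaving b leaves′) (crossing-leaving b leaves″) ⟩
        classWeight b true β + classWeight b true (c u″)
          ≡⟨ cong₂ _+_ weight (trans (cong (classWeight b true) (sym same)) weight) ⟩
        r + r                             ∎
        where
        internal : ∀ e → e ≢ e′ → e ≢ e″ → crossing b e ≡ 0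
        internal e e≢e′ e≢e″ = crossing-internal b e
          (λ S₁ → closed _ _ S₁ (fwd e (e≢e′ , e≢e″) here))
          (λ S₂ → closed _ _ S₂ (bwd e (e≢e′ , e≢e″) here))

lemma1 : (G : Multigraph) (k : ℕ) → k ≥ 3 →
    Connected G → Bipartite G → Regular G k →
    (e′ e″ : Edge G) →
    (∀ v → Incident G e′ v → ¬ Incident G e″ v) →
    (H : Vertex G → Set) →
    IsComponent G (λ e → ¬ (e ≡ e′) × ¬ (e ≡ e″)) H →
    (u′ u″ : Vertex G) →
    Incident G e′ u′ → H u′ → (∀ v → Incident G e′ v → H v → v ≡ u′) →
    Incident G e″ u″ → H u″ → (∀ v → Incident G e″ v → H v → v ≡ u″) →
    (c : Vertex G → Bool) → ProperTwoColouring G c →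
    ¬ (c u′ ≡ c u″)
lemma1 G k k≥3 _ _ regular e′ e″ disjoint H (_ , _ , closed) u′ u″ e′∋u′ Hu′ unique′ e″∋u″ Hu″ unique″ c proper same =
  -- The goal is a negation, so membership in H may be assumed decidable.
  ¬¬-decidable H λ H? →
    multiple≢multiple+2 k≥3
      (two-edges-leaving G H? c e′≢e″ closed (e′∋u′ , Hu′ , unique′) (e″∋u″ , Hu″ , unique″) same regular proper)
  where
  e′≢e″ : e′ ≢ e″
  e′≢e″ refl = disjoint u′ e′∋u′ e′∋u′
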